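{- For every integer $n\ge 2$, the ladder graph $L_n$ satisfies $F_{cd}(L_n) = F_{cd}(G_{2,n}) = n$.
   Context: For positive integers $p\le q$, the grid graph $G_{p,q}$ has vertex set $\{(i,j): 1\le i\le p,\ 1\le j\le q\}$, with $(i,j)$ adjacent to $(i,j+1)$ and to $(i+1,j)$ whenever these are vertices. The ladder graph $L_n = P_n\,\Box\, K_2$ is $G_{2,n}$. Color-change rule: if each vertex is colored black or white, and a black vertex $u$ has exactly one white neighbor $v$, then $v$ is recolored black. A zero forcing set is a vertex set $Z$ such that, starting with exactly the vertices of $Z$ black, repeated application of the color-change rule colors every vertex black. A connected dom-forcing set is a vertex set $S$ that is dominating (every vertex is in $S$ or adjacent to a vertex of $S$), induces a connected subgraph, and is a zero forcing set; $F_{cd}(\cdot)$ is the minimum size of such a set. -}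

module Defs where

open import Data.Nat using (ℕ; zero; suc; _+_; _≤_)
open import Data.Fin using (Fin; toℕ) renaming (zero to fzero; suc to fsuc)
open import Data.Fin.Properties using () renaming (_≟_ to _≟ᶠ_)
open import Data.Bool using (Bool; true; false; _∨_; if_then_else_)
open import Data.Product using (Σ; _×_; _,_; ∃)
open import Data.Sum using (_⊎_)
open import Relation.Binary.PropositionalEquality using (_≡_)
open import Relation.Nullary.Decidable using (⌊_⌋)
open import Relation.Nullary using (_×-dec_)
open import Relation.Binary.Construct.Closure.ReflexiveTransitive using (Star)

-- Vertices of the grid graph G_{p,q}: pairs (i , j) with 0 ≤ i < p, 0 ≤ j < q
-- (0-based version of the paper's 1-based indexing).
Vertex : ℕ → ℕ → Set
Vertex p q = Fin p × Fin q

Adj : ∀ {p q} → Vertex p q → Vertex p q → Set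
Adj (i , j) (i' , j') =
  (i ≡ i' × (suc (toℕ j) ≡ toℕ j' ⊎ suc (toℕ j') ≡ toℕ j))
  ⊎ (j ≡ j' × (suc (toℕ i) ≡ toℕ i' ⊎ suc (toℕ i') ≡ toℕ i))

-- A vertex set (equivalently a black/white colouring; true = black).
VSet : ℕ → ℕ → Set
VSet p q = Vertex p q → Bool

_=ᵛ_ : ∀ {p q} → Vertex p q → Vertex p q → Bool
(i , j) =ᵛ (i' , j') = ⌊ (i ≟ᶠ i') ×-dec (j ≟ᶠ j') ⌋

Forces : ∀ {p q} → VSet p q → Vertex p q → Vertex p q → Set
Forces B u v =
  B u ≡ true × Adj u v × B v ≡ false
  × (∀ w → Adj u w → B w ≡ false → w ≡ v)

Step : ∀ {p q} → VSet p q → VSet p q → Set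
Step B B' = Σ _ λ u → Σ _ λ v → Forces B u v × (B' ≡ (λ x → B x ∨ (x =ᵛ v)))

ZeroForcing : ∀ {p q} → VSet p q → Set
ZeroForcing Z = Σ _ λ B → Star Step Z B × (∀ x → B x ≡ true)

Dominating : ∀ {p q} → VSet p q → Set
Dominating S = ∀ x → S x ≡ true ⊎ (Σ _ λ y → S y ≡ true × Adj x y)

InducedEdge : ∀ {p q} → VSet p q → Vertex p q → Vertex p q → Set
InducedEdge S a b = S a ≡ true × S b ≡ true × Adj a b

InducesConnected : ∀ {p q} → VSet p q → Set
InducesConnected S = ∀ x y → S x ≡ true → S y ≡ true → Star (InducedEdge S) x y

ConnectedDomForcing : ∀ {p q} → VSet p q → Set
ConnectedDomForcing S = Dominating S × InducesConnected S × ZeroForcing S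

sumFin : ∀ n → (Fin n → ℕ) → ℕ
sumFin zero f = 0
sumFin (suc n) f = f fzero + sumFin n (λ i → f (fsuc i))

size : ∀ {p q} → VSet p q → ℕ
size {p} {q} S = sumFin p λ i → sumFin q λ j → if S (i , j) then 1 else 0

FcdGrid≡ : ℕ → ℕ → ℕ → Set
FcdGrid≡ p q k =
  (Σ (VSet p q) λ S → ConnectedDomForcing S × size S ≡ k)
  × (∀ (S : VSet p q) → ConnectedDomForcing S → k ≤ size S)

-- The ladder L_n = P_n □ K_2 is G_{2,n}.
FcdLadder≡ : ℕ → ℕ → Set
FcdLadder≡ n k = FcdGrid≡ 2 n k

module Submission where

-- The top row of L_n is connected and dominating, and it forces the bottom row column by
-- column, so F_cd(L_n) ≤ n.  Conversely, count a connected dom-forcing set S column by column.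
-- S meets every inner column, because the dominators of the two end corners are joined by a
-- path inside S.  An empty end column has both of its vertices dominated from the adjacent
-- column, which is then full.  Both end columns can be empty only if the two full columns are
-- distinct (n ≥ 4); for n = 3 such an S is confined to the middle column and no vertex can
-- force.  In every case the column sizes add up to at least n.

open import Defs
open import Data.Nat using (ℕ; _≤_)
open import Data.Nat using (zero; suc; _+_; _*_; _<_; z≤n; s≤s; s≤s⁻¹; _≟_; _<?_)
open import Data.Nat.Properties
open import Data.Fin using (Fin; toℕ; fromℕ; fromℕ<) renaming (zero to fzero; suc to fsuc)
open import Data.Fin.Properties using (toℕ-injective; toℕ<n; toℕ-fromℕ; fromℕ<-toℕ; toℕ-fromℕ<)
  renaming (_≟_ to _≟ᶠ_)
open import Data.Bool using (Bool; true; false; _∨_; if_then_else_)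
open import Data.Bool.Properties using (∨-zeroʳ)
open import Data.Product using (_×_; _,_; ∃; proj₁; proj₂)
open import Data.Sum using (_⊎_; inj₁; inj₂)
open import Data.Empty using (⊥-elim)
open import Relation.Nullary using (¬_; yes; no; _×-dec_)
open import Relation.Nullary.Decidable using (isYes≗does; dec-true; dec-false)
open import Relation.Binary.PropositionalEquality
open import Relation.Binary.Construct.Closure.ReflexiveTransitive using (Star; ε; _◅_; _◅◅_; reverse)
open import Algebra.Properties.CommutativeSemigroup +-commutativeSemigroup using (interchange)

sumℕ : ℕ → (ℕ → ℕ) → ℕ
sumℕ zero    g = 0
sumℕ (suc n) g = g 0 + sumℕ n (λ k → g (suc k))

sumℕ-suc : ∀ n g → sumℕ (suc n) g ≡ sumℕ n g + g n
sumℕ-suc zero    g = +-comm (g 0) 0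
sumℕ-suc (suc n) g =
  trans (cong (g 0 +_) (sumℕ-suc n (λ k → g (suc k)))) (sym (+-assoc (g 0) _ _))

sumℕ-suc-suc : ∀ n g → sumℕ (suc (suc n)) g ≡ sumℕ n g + (g n + g (suc n))
sumℕ-suc-suc n g = begin
  sumℕ (suc (suc n)) g               ≡⟨ sumℕ-suc (suc n) g ⟩
  sumℕ (suc n) g + g (suc n)         ≡⟨ cong (_+ g (suc n)) (sumℕ-suc n g) ⟩
  sumℕ n g + g n + g (suc n)         ≡⟨ +-assoc (sumℕ n g) (g n) (g (suc n)) ⟩
  sumℕ n g + (g n + g (suc n))       ∎
  where open ≡-Reasoning

n≤sumℕ : ∀ n g → (∀ k → k < n → 1 ≤ g k) → n ≤ sumℕ n g
n≤sumℕ zero    g pos = z≤n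
n≤sumℕ (suc n) g pos =
  +-mono-≤ (pos 0 (s≤s z≤n)) (n≤sumℕ n (λ k → g (suc k)) (λ k k<n → pos (suc k) (s≤s k<n)))

sumFin-cong : ∀ n {f g : Fin n → ℕ} → (∀ j → f j ≡ g j) → sumFin n f ≡ sumFin n g
sumFin-cong zero    f≗g = refl
sumFin-cong (suc n) f≗g = cong₂ _+_ (f≗g fzero) (sumFin-cong n (λ j → f≗g (fsuc j)))

sumFin-+ : ∀ n (f g : Fin n → ℕ) → sumFin n f + sumFin n g ≡ sumFin n (λ j → f j + g j)
sumFin-+ zero    f g = refl
sumFin-+ (suc n) f g =
  trans (interchange (f fzero) _ (g fzero) _)
        (cong (f fzero + g fzero +_) (sumFin-+ n (λ j → f (fsuc j)) (λ j → g (fsuc j))))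

sumFin-const : ∀ n c → sumFin n (λ _ → c) ≡ n * c
sumFin-const zero    c = refl
sumFin-const (suc n) c = cong (c +_) (sumFin-const n c)

sumFin-toℕ : ∀ n g → sumFin n (λ j → g (toℕ j)) ≡ sumℕ n g
sumFin-toℕ zero    g = refl
sumFin-toℕ (suc n) g = cong (g 0 +_) (sumFin-toℕ n (λ k → g (suc k)))

extend : ∀ {n} → (Fin n → ℕ) → ℕ → ℕ
extend {n} f k with k <? n
... | yes k<n = f (fromℕ< k<n)
... | no  _   = 0

extend-toℕ : ∀ {n} (f : Fin n → ℕ) j → extend f (toℕ j) ≡ f j
extend-toℕ {n} f j with toℕ j <? n
... | yes j<n = cong f (fromℕ<-toℕ j j<n)
... | no  j≮n = ⊥-elim (j≮n (toℕ<n j))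

sumFin-extend : ∀ n (f : Fin n → ℕ) → sumFin n f ≡ sumℕ n (extend f)
sumFin-extend n f = trans (sumFin-cong n (λ j → sym (extend-toℕ f j))) (sumFin-toℕ n (extend f))

2≤+ˡ : ∀ {a b} → (a ≡ 0 → 2 ≤ b) → 1 ≤ b → 2 ≤ a + b
2≤+ˡ {zero}  a≡0⇒2≤b _   = a≡0⇒2≤b refl
2≤+ˡ {suc a} _       1≤b = s≤s (≤-trans 1≤b (m≤n+m _ a))

2≤+ʳ : ∀ {a b} → (b ≡ 0 → 2 ≤ a) → 1 ≤ a → 2 ≤ a + b
2≤+ʳ {a} {b} b≡0⇒2≤a 1≤a = subst (2 ≤_) (+-comm b a) (2≤+ˡ b≡0⇒2≤a 1≤a)

-- For m ≥ 2 the first two and the last two columns are disjoint and each pair holds at least 2.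
sumℕ-lowerBound : ∀ m (g : ℕ → ℕ)
  → (∀ k → 1 ≤ k → k ≤ m → 1 ≤ g k)
  → (g 0 ≡ 0 → 2 ≤ g 1)
  → (g (suc m) ≡ 0 → 2 ≤ g m)
  → (m ≡ 1 → g 0 ≡ 0 → g 2 ≢ 0)
  → 2 + m ≤ sumℕ (2 + m) g
sumℕ-lowerBound zero g _ first last _ rewrite +-identityʳ (g 1) with g 0 ≟ 0
... | yes g0≡0 = ≤-trans (first g0≡0) (m≤n+m (g 1) (g 0))
... | no  g0≢0 = 2≤+ʳ last (n≢0⇒n>0 g0≢0)
sumℕ-lowerBound (suc zero) g inner first last notBoth rewrite +-identityʳ (g 2) with g 0 ≟ 0
... | yes g0≡0 =
  ≤-trans (+-mono-≤ (first g0≡0) (n≢0⇒n>0 (notBoth refl g0≡0))) (m≤n+m (g 1 + g 2) (g 0))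
... | no  g0≢0 = +-mono-≤ (n≢0⇒n>0 g0≢0) (2≤+ʳ last (inner 1 ≤-refl ≤-refl))
sumℕ-lowerBound (suc (suc k)) g inner first last _ = begin
  2 + (2 + k)                                 ≡⟨ cong (2 +_) (+-comm 2 k) ⟩
  2 + (k + 2)                                 ≤⟨ +-mono-≤ firstPair (+-mono-≤ middle lastPair) ⟩
  (g 0 + g 1) + (sumℕ k h + (h k + h (suc k))) ≡⟨ +-assoc (g 0) (g 1) _ ⟩
  g 0 + (g 1 + (sumℕ k h + (h k + h (suc k)))) ≡⟨ cong (λ t → g 0 + (g 1 + t)) (sym (sumℕ-suc-suc k h)) ⟩
  sumℕ (4 + k) g                              ∎
  where
  open ≤-Reasoning
  h : ℕ → ℕ
  h i = g (2 + i)
  firstPair : 2 ≤ g 0 + g 1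
  firstPair = 2≤+ˡ first (inner 1 ≤-refl (s≤s z≤n))
  lastPair : 2 ≤ h k + h (suc k)
  lastPair = 2≤+ʳ last (inner (2 + k) (s≤s z≤n) ≤-refl)
  middle : k ≤ sumℕ k h
  middle = n≤sumℕ k h (λ i i<k → inner (2 + i) (s≤s z≤n) (s≤s (s≤s (<⇒≤ i<k))))

column : ∀ {p q} → Vertex p q → ℕ
column (_ , j) = toℕ j

≡true⇒≢false : ∀ {b} → b ≡ true → b ≢ false
≡true⇒≢false refl ()

Adj-sym : ∀ {p q} {x y : Vertex p q} → Adj x y → Adj y x
Adj-sym (inj₁ (i≡i' , inj₁ j+1≡j')) = inj₁ (sym i≡i' , inj₂ j+1≡j')
Adj-sym (inj₁ (i≡i' , inj₂ j'+1≡j)) = inj₁ (sym i≡i' , inj₁ j'+1≡j)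
Adj-sym (inj₂ (j≡j' , inj₁ i+1≡i')) = inj₂ (sym j≡j' , inj₂ i+1≡i')
Adj-sym (inj₂ (j≡j' , inj₂ i'+1≡i)) = inj₂ (sym j≡j' , inj₁ i'+1≡i)

column-Adj : ∀ {p q} {x y : Vertex p q} → Adj x y → column y ≤ suc (column x)
column-Adj (inj₁ (_ , inj₁ j+1≡j')) = ≤-reflexive (sym j+1≡j')
column-Adj (inj₁ (_ , inj₂ j'+1≡j)) = m<n⇒m≤1+n (≤-reflexive j'+1≡j)
column-Adj (inj₂ (refl , _))        = n≤1+n _

InducedEdge-sym : ∀ {p q} {S : VSet p q} {x y} → InducedEdge S x y → InducedEdge S y x
InducedEdge-sym (Sx , Sy , x~y) = Sy , Sx , Adj-sym x~y

path-meetsColumn : ∀ {p q} {S : VSet p q} {x y} k → Star (InducedEdge S) x y → S x ≡ true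
  → column x ≤ k → k ≤ column y → ∃ λ z → S z ≡ true × column z ≡ k
path-meetsColumn k ε Sx x≤k k≤x = _ , Sx , ≤-antisym x≤k k≤x
path-meetsColumn {x = x} k ((_ , Sx' , x~x') ◅ path) Sx x≤k k≤y with column x ≟ k
... | yes x≡k = x , Sx , x≡k
... | no  x≢k = path-meetsColumn k path Sx' (≤-trans (column-Adj x~x') (≤∧≢⇒< x≤k x≢k)) k≤y

dominator-nearby : ∀ {p q} {S : VSet p q} → Dominating S → ∀ x
  → ∃ λ y → S y ≡ true × column y ≤ suc (column x) × column x ≤ suc (column y)
dominator-nearby dom x with dom x
... | inj₁ Sx             = x , Sx , n≤1+n _ , n≤1+n _
... | inj₂ (y , Sy , x~y) = y , Sy , column-Adj x~y , column-Adj (Adj-sym x~y)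

-- The dominators of the two end corners are joined by a path inside S, which crosses every
-- column in between.
connectedDominating-meetsInnerColumns : ∀ {p m} {S : VSet (suc p) (suc (suc m))}
  → Dominating S → InducesConnected S
  → ∀ k → 1 ≤ k → k ≤ m → ∃ λ z → S z ≡ true × column z ≡ k
connectedDominating-meetsInnerColumns {m = m} dom conn k 1≤k k≤m
  with dominator-nearby dom (fzero , fzero) | dominator-nearby dom (fzero , fromℕ (suc m))
... | x , Sx , x≤1 , _ | y , Sy , _ , last≤y+1 =
  path-meetsColumn k (conn x y Sx Sy) Sx (≤-trans x≤1 1≤k)
    (≤-trans k≤m (s≤s⁻¹ (subst (_≤ suc (column y)) (toℕ-fromℕ (suc m)) last≤y+1)))

emptyColumn-dominators : ∀ {p q} {S : VSet p q} → Dominating S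
  → ∀ {j} → (∀ i → S (i , j) ≡ false)
  → ∀ i → ∃ λ j' → S (i , j') ≡ true × (suc (toℕ j) ≡ toℕ j' ⊎ suc (toℕ j') ≡ toℕ j)
emptyColumn-dominators dom {j} empty i with dom (i , j)
... | inj₁ S-ij = ⊥-elim (≡true⇒≢false S-ij (empty i))
... | inj₂ ((_ , j') , Sy , inj₁ (refl , j~j')) = j' , Sy , j~j'
... | inj₂ ((i' , _) , Sy , inj₂ (refl , _))    = ⊥-elim (≡true⇒≢false Sy (empty i'))

stalled⇒¬ZeroForcing : ∀ {p q} {S : VSet p q} → (∀ u v → ¬ Forces S u v)
  → ∀ x → S x ≡ false → ¬ ZeroForcing S
stalled⇒¬ZeroForcing _       x Sx≡false (_ , ε , allBlack) = ≡true⇒≢false (allBlack x) Sx≡false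
stalled⇒¬ZeroForcing noForce _ _ (_ , (u , v , u→v , _) ◅ _ , _) = noForce u v u→v

bit : Bool → ℕ
bit b = if b then 1 else 0

columnSize : ∀ {q} → VSet 2 q → Fin q → ℕ
columnSize S j = bit (S (fzero , j)) + bit (S (fsuc fzero , j))

size≡sumℕ-columnSize : ∀ {q} (S : VSet 2 q) → size S ≡ sumℕ q (extend (columnSize S))
size≡sumℕ-columnSize {q} S = begin
  size S                                                  ≡⟨ cong (top +_) (+-identityʳ bottom) ⟩
  top + bottom                                            ≡⟨ sumFin-+ q _ _ ⟩
  sumFin q (columnSize S)                                 ≡⟨ sumFin-extend q (columnSize S) ⟩
  sumℕ q (extend (columnSize S))                          ∎
  where
  open ≡-Reasoning
  top bottom : ℕ
  top    = sumFin q λ j → bit (S (fzero , j))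
  bottom = sumFin q λ j → bit (S (fsuc fzero , j))

member⇒1≤columnSize : ∀ {q} {S : VSet 2 q} z → S z ≡ true → 1 ≤ extend (columnSize S) (column z)
member⇒1≤columnSize {S = S} (fzero , j) Sz rewrite extend-toℕ (columnSize S) j | Sz = s≤s z≤n
member⇒1≤columnSize {S = S} (fsuc fzero , j) Sz rewrite extend-toℕ (columnSize S) j | Sz =
  m≤n+m 1 (bit (S (fzero , j)))

bit+bit≡0 : ∀ a b → bit a + bit b ≡ 0 → a ≡ false × b ≡ false
bit+bit≡0 false false _ = refl , refl
bit+bit≡0 false true  ()
bit+bit≡0 true  _     ()

columnSize≡0⇒empty : ∀ {q} (S : VSet 2 q) j → columnSize S j ≡ 0 → ∀ i → S (i , j) ≡ false
columnSize≡0⇒empty S j size≡0 fzero        = proj₁ (bit+bit≡0 _ _ size≡0)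
columnSize≡0⇒empty S j size≡0 (fsuc fzero) = proj₂ (bit+bit≡0 _ _ size≡0)

full⇒columnSize≡2 : ∀ {q} {S : VSet 2 q} j → S (fzero , j) ≡ true → S (fsuc fzero , j) ≡ true
  → columnSize S j ≡ 2
full⇒columnSize≡2 j S0j S1j rewrite S0j | S1j = refl

-- Both vertices of an empty column are dominated horizontally, so a unique neighbouring
-- column must be full.
emptyColumn⇒neighbourFull : ∀ {q} {S : VSet 2 q} → Dominating S → ∀ j t
  → columnSize S j ≡ 0
  → (∀ (j' : Fin q) → suc (toℕ j) ≡ toℕ j' ⊎ suc (toℕ j') ≡ toℕ j → toℕ j' ≡ t)
  → extend (columnSize S) t ≡ 2
emptyColumn⇒neighbourFull {S = S} dom j t size≡0 onlyNeighbour
  with emptyColumn-dominators dom (columnSize≡0⇒empty S j size≡0) fzero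
     | emptyColumn-dominators dom (columnSize≡0⇒empty S j size≡0) (fsuc fzero)
... | j₀ , S0j₀ , j~j₀ | j₁ , S1j₁ , j~j₁
  with toℕ-injective (trans (onlyNeighbour j₀ j~j₀) (sym (onlyNeighbour j₁ j~j₁)))
... | refl = begin
  extend (columnSize S) t            ≡⟨ cong (extend (columnSize S)) (sym (onlyNeighbour j₀ j~j₀)) ⟩
  extend (columnSize S) (toℕ j₀)     ≡⟨ extend-toℕ (columnSize S) j₀ ⟩
  columnSize S j₀                    ≡⟨ full⇒columnSize≡2 {S = S} j₀ S0j₀ S1j₁ ⟩
  2                                  ∎
  where open ≡-Reasoning

module _ {m : ℕ} {S : VSet 2 (suc (suc m))} (dom : Dominating S) where

  connectedDominating⇒1≤innerColumnSize : InducesConnected S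
    → ∀ k → 1 ≤ k → k ≤ m → 1 ≤ extend (columnSize S) k
  connectedDominating⇒1≤innerColumnSize conn k 1≤k k≤m
    with connectedDominating-meetsInnerColumns dom conn k 1≤k k≤m
  ... | z , Sz , refl = member⇒1≤columnSize {S = S} z Sz

  emptyFirstColumn⇒2≤secondColumnSize : extend (columnSize S) 0 ≡ 0 → 2 ≤ extend (columnSize S) 1
  emptyFirstColumn⇒2≤secondColumnSize first≡0 =
    ≤-reflexive (sym (emptyColumn⇒neighbourFull dom fzero 1 first≡0 onlySecond))
    where
    onlySecond : ∀ (j : Fin (suc (suc m))) → 1 ≡ toℕ j ⊎ suc (toℕ j) ≡ 0 → toℕ j ≡ 1
    onlySecond _ (inj₁ 1≡j) = sym 1≡j

  emptyLastColumn⇒2≤penultimateColumnSize : extend (columnSize S) (suc m) ≡ 0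
    → 2 ≤ extend (columnSize S) m
  emptyLastColumn⇒2≤penultimateColumnSize last≡0 =
    ≤-reflexive (sym (emptyColumn⇒neighbourFull dom lastCol m lastSize≡0 onlyPenultimate))
    where
    lastCol : Fin (suc (suc m))
    lastCol = fromℕ (suc m)
    lastSize≡0 : columnSize S lastCol ≡ 0
    lastSize≡0 = trans (sym (extend-toℕ (columnSize S) lastCol))
                       (trans (cong (extend (columnSize S)) (toℕ-fromℕ (suc m))) last≡0)
    onlyPenultimate : ∀ j → suc (toℕ lastCol) ≡ toℕ j ⊎ suc (toℕ j) ≡ toℕ lastCol → toℕ j ≡ m
    onlyPenultimate j (inj₁ last+1≡j) =
      ⊥-elim (<-irrefl (trans (sym last+1≡j) (cong suc (toℕ-fromℕ (suc m)))) (toℕ<n j))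
    onlyPenultimate j (inj₂ j+1≡last) = suc-injective (trans j+1≡last (toℕ-fromℕ (suc m)))

-- With both outer columns empty, every black vertex lies in the middle column and has two
-- white neighbours, so no colour change is possible.
emptyOuterColumns⇒¬ZeroForcing : (S : VSet 2 3)
  → extend (columnSize S) 0 ≡ 0 → extend (columnSize S) 2 ≡ 0 → ¬ ZeroForcing S
emptyOuterColumns⇒¬ZeroForcing S first≡0 last≡0 =
  stalled⇒¬ZeroForcing noForce (fzero , fzero) (empty₀ fzero)
  where
  empty₀ : ∀ i → S (i , fzero) ≡ false
  empty₀ = columnSize≡0⇒empty S fzero first≡0
  empty₂ : ∀ i → S (i , fsuc (fsuc fzero)) ≡ false
  empty₂ = columnSize≡0⇒empty S (fsuc (fsuc fzero)) last≡0
  noForce : ∀ u v → ¬ Forces S u v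
  noForce (i , fzero) _ (Su , _) = ≡true⇒≢false Su (empty₀ i)
  noForce (i , fsuc (fsuc fzero)) _ (Su , _) = ≡true⇒≢false Su (empty₂ i)
  noForce (i , fsuc fzero) _ (_ , _ , _ , onlyWhite)
    with trans (onlyWhite (i , fzero) (inj₁ (refl , inj₂ refl)) (empty₀ i))
               (sym (onlyWhite (i , fsuc (fsuc fzero)) (inj₁ (refl , inj₁ refl)) (empty₂ i)))
  ... | ()

row-connected : ∀ {p q} {S : VSet p (suc q)} i → (∀ j → S (i , j) ≡ true)
  → ∀ a b → Star (InducedEdge S) (i , a) (i , b)
row-connected {q = q} {S} i rowBlack a b =
  toFirst (toℕ a) a refl ◅◅ reverse InducedEdge-sym (toFirst (toℕ b) b refl)
  where
  toFirst : ∀ k a → toℕ a ≡ k → Star (InducedEdge S) (i , a) (i , fzero)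
  toFirst zero    a a≡0   = subst (λ a → Star (InducedEdge S) (i , a) (i , fzero))
                                  (sym (toℕ-injective {j = fzero} a≡0)) ε
  toFirst (suc k) a a≡k+1 =
    (rowBlack a , rowBlack prev , inj₁ (refl , inj₂ (trans (cong suc (toℕ-fromℕ< k<q+1)) (sym a≡k+1))))
    ◅ toFirst k prev (toℕ-fromℕ< k<q+1)
    where
    k<q+1 : k < suc q
    k<q+1 = <-trans (n<1+n k) (subst (_< suc q) a≡k+1 (toℕ<n a))
    prev : Fin (suc q)
    prev = fromℕ< k<q+1

topRow : ∀ {q} → VSet 2 q
topRow (fzero  , _) = true
topRow (fsuc _ , _) = false

size-topRow : ∀ q → size (topRow {q}) ≡ q
size-topRow q = begin
  sumFin q (λ _ → 1) + (sumFin q (λ _ → 0) + 0) ≡⟨ cong₂ _+_ (sumFin-const q 1) (+-identityʳ _) ⟩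
  q * 1 + sumFin q (λ _ → 0)                    ≡⟨ cong₂ _+_ (*-identityʳ q) (sumFin-const q 0) ⟩
  q + q * 0                                     ≡⟨ cong (q +_) (*-zeroʳ q) ⟩
  q + 0                                         ≡⟨ +-identityʳ q ⟩
  q                                             ∎
  where open ≡-Reasoning

topRow-dominating : ∀ {q} → Dominating (topRow {q})
topRow-dominating (fzero      , j) = inj₁ refl
topRow-dominating (fsuc fzero , j) = inj₂ ((fzero , j) , refl , inj₂ (refl , inj₂ refl))

topRow-connected : ∀ {q} → InducesConnected (topRow {suc q})
topRow-connected (fzero , a) (fzero , b) _ _ = row-connected fzero (λ _ → refl) a b

=ᵛ-refl : ∀ {p q} (x : Vertex p q) → (x =ᵛ x) ≡ true
=ᵛ-refl (i , j) =
  trans (isYes≗does ((i ≟ᶠ i) ×-dec (j ≟ᶠ j))) (dec-true ((i ≟ᶠ i) ×-dec (j ≟ᶠ j)) (refl , refl))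

=ᵛ-≢ : ∀ {p q} {x y : Vertex p q} → x ≢ y → (x =ᵛ y) ≡ false
=ᵛ-≢ {x = i , j} {i' , j'} x≢y =
  trans (isYes≗does ((i ≟ᶠ i') ×-dec (j ≟ᶠ j')))
        (dec-false ((i ≟ᶠ i') ×-dec (j ≟ᶠ j')) (λ (i≡i' , j≡j') → x≢y (cong₂ _,_ i≡i' j≡j')))

blackTopRow⇒forcesBelow : ∀ {q} {B : VSet 2 q} j → (∀ j' → B (fzero , j') ≡ true)
  → B (fsuc fzero , j) ≡ false → Forces B (fzero , j) (fsuc fzero , j)
blackTopRow⇒forcesBelow {B = B} j topBlack white =
  topBlack j , inj₂ (refl , inj₁ refl) , white , onlyWhite
  where
  onlyWhite : ∀ w → Adj (fzero , j) w → B w ≡ false → w ≡ (fsuc fzero , j)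
  onlyWhite (fzero , j') _ Bw = ⊥-elim (≡true⇒≢false (topBlack j') Bw)
  onlyWhite (fsuc fzero , _) (inj₁ (() , _)) _
  onlyWhite (fsuc fzero , _) (inj₂ (refl , _)) _ = refl

-- Recursive, so that each stage is literally the colouring produced by a Step: there is no
-- function extensionality to identify it with a closed-form colouring.
fillBelow : ∀ {q} k → .(k ≤ q) → VSet 2 q
fillBelow zero    _   = topRow
fillBelow (suc k) k<q = λ x → fillBelow k (<⇒≤ k<q) x ∨ (x =ᵛ (fsuc fzero , fromℕ< k<q))

module _ {q : ℕ} where

  fillBelow-top : ∀ k .(k≤q : k ≤ q) j → fillBelow k k≤q (fzero , j) ≡ true
  fillBelow-top zero    _   j = refl
  fillBelow-top (suc k) k<q j rewrite fillBelow-top k (<⇒≤ k<q) j = refl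

  fillBelow-< : ∀ k .(k≤q : k ≤ q) j → toℕ j < k → fillBelow k k≤q (fsuc fzero , j) ≡ true
  fillBelow-< (suc k) k<q j j<k+1 with toℕ j ≟ k
  ... | yes j≡k rewrite toℕ-injective {j = fromℕ< k<q} (trans j≡k (sym (toℕ-fromℕ< k<q)))
    = trans (cong (fillBelow k (<⇒≤ k<q) (fsuc fzero , fromℕ< k<q) ∨_) (=ᵛ-refl (fsuc fzero , fromℕ< k<q)))
            (∨-zeroʳ _)
  ... | no  j≢k rewrite fillBelow-< k (<⇒≤ k<q) j (≤∧≢⇒< (s≤s⁻¹ j<k+1) j≢k) = refl

  fillBelow-≥ : ∀ k .(k≤q : k ≤ q) j → k ≤ toℕ j → fillBelow k k≤q (fsuc fzero , j) ≡ false
  fillBelow-≥ zero    _   j _     = refl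
  fillBelow-≥ (suc k) k<q j k<j rewrite fillBelow-≥ k (<⇒≤ k<q) j (<⇒≤ k<j) = =ᵛ-≢ j≢k
    where
    j≢k : (fsuc fzero , j) ≢ (fsuc fzero , fromℕ< k<q)
    j≢k j≡k = <-irrefl (sym (trans (cong column j≡k) (toℕ-fromℕ< k<q))) k<j

  fillBelow-step : ∀ k .(k<q : k < q) → Step (fillBelow k (<⇒≤ k<q)) (fillBelow (suc k) k<q)
  fillBelow-step k k<q =
    (fzero , col) , (fsuc fzero , col) ,
    blackTopRow⇒forcesBelow col (fillBelow-top k _) (fillBelow-≥ k _ col (≤-reflexive (sym (toℕ-fromℕ< k<q)))) ,
    refl
    where
    col : Fin q
    col = fromℕ< k<q

  fillBelow-reachable : ∀ k .(k≤q : k ≤ q) → Star Step topRow (fillBelow k k≤q)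
  fillBelow-reachable zero    _   = ε
  fillBelow-reachable (suc k) k<q = fillBelow-reachable k (<⇒≤ k<q) ◅◅ (fillBelow-step k k<q ◅ ε)

  topRow-zeroForcing : ZeroForcing (topRow {q})
  topRow-zeroForcing = fillBelow q ≤-refl , fillBelow-reachable q ≤-refl , allBlack
    where
    allBlack : ∀ x → fillBelow q ≤-refl x ≡ true
    allBlack (fzero      , j) = fillBelow-top q ≤-refl j
    allBlack (fsuc fzero , j) = fillBelow-< q ≤-refl j (toℕ<n j)

mainTheorem15 : ∀ (n : ℕ) → 2 ≤ n → FcdLadder≡ n n
mainTheorem15 (suc zero) (s≤s ())
mainTheorem15 (suc (suc m)) _ =
  (topRow , (topRow-dominating , topRow-connected , topRow-zeroForcing) , size-topRow (2 + m)) ,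
  lowerBound
  where
  lowerBound : ∀ S → ConnectedDomForcing S → 2 + m ≤ size S
  lowerBound S (dom , conn , zf) =
    subst (2 + m ≤_) (sym (size≡sumℕ-columnSize S))
      (sumℕ-lowerBound m (extend (columnSize S))
        (connectedDominating⇒1≤innerColumnSize dom conn)
        (emptyFirstColumn⇒2≤secondColumnSize dom)
        (emptyLastColumn⇒2≤penultimateColumnSize dom)
        (λ { refl first≡0 last≡0 → emptyOuterColumns⇒¬ZeroForcing S first≡0 last≡0 zf }))
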